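{- Let $M\in\Sigma^{n\times n}$ and let $\Gamma_{2D}$ be a (not necessarily minimum) two-dimensional attractor for $M$ of size $\gamma$. Then, for $k=O(1)$, the 2D-BT built using $\Gamma_{2D}$ takes $O(\gamma\log\frac{n}{\gamma})$ space.
   Context: An occurrence of an $\ell\times\ell$ matrix $I$ in $M$ is a position $(i',j')$ with $M[i':i'+\ell-1][j':j'+\ell-1]=I$ (rows $i',\dots,i'+\ell-1$, columns $j',\dots,j'+\ell-1$); it crosses $p=(a,b)$ if $i'\le a\le i'+\ell-1$ and $j'\le b\le j'+\ell-1$. A two-dimensional attractor for $M$ is a set $\Gamma_{2D}\subseteq\{1,\dots,n\}^2$ such that every square submatrix of $M$ has an occurrence crossing some position of $\Gamma_{2D}$. The 2D-BT built using $\Gamma_{2D}$, with integer parameter $k\ge2$ (assuming $\sqrt\gamma$ integer and $n=\sqrt{\gamma}\,k^\alpha$): the root represents $M$ and its children are the $\gamma$ aligned blocks of side $s_1=k^\alpha$ partitioning $M$; at level $\ell\ge1$ blocks are aligned submatrices of side $s_\ell=k^{\alpha-\ell+1}$, and the nodes of level $\ell+1$ are the $k^2$ blocks partitioning the block of each marked node of level $\ell$. At each level, a node is marked iff its block contains a position of $\Gamma_{2D}$ or is one of the (at most 8) blocks adjacent (sharing a side or a corner) to a block containing a position of $\Gamma_{2D}$. Marked nodes are split recursively down to constant-size blocks stored explicitly; an unmarked node is a leaf storing a pointer to the marked block of the same level where an occurrence of its block crossing a position of $\Gamma_{2D}$ begins, plus the relative offset. Each node occupies $O(1)$ words; space is measured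 in words. -}

module Defs where

open import Data.Nat using (ℕ; zero; suc; _+_; _*_; _∸_; _^_; _≤_; _<_; _≤?_; _<?_)
open import Data.Fin using (Fin; toℕ)
open import Data.Product using (Σ; ∃; _×_; _,_; proj₁; proj₂)
open import Data.List using (List; []; _∷_; length; map; concatMap; upTo; filter)
open import Data.Nat.ListAction using (sum)
open import Data.List.Membership.Propositional using (_∈_)
open import Data.List.Relation.Unary.Any using (Any; any?)
open import Relation.Binary.PropositionalEquality using (_≡_)
open import Relation.Nullary using (Dec)
open import Relation.Nullary.Decidable using (_×-dec_)

-- A matrix over alphabet A of size n×n (0-based indices; the paper's {1..n}
-- is shifted by one, which changes nothing).
Matrix : Set → ℕ → Set
Matrix A n = Fin n → Fin n → A

Pos : ℕ → Set
Pos n = Fin n × Fin n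

SameSquare : {A : Set} {n : ℕ} → Matrix A n → (ℓ i j i' j' : ℕ) → Set
SameSquare {n = n} M ℓ i j i' j' =
  (a b : ℕ) → a < ℓ → b < ℓ →
  (x y x' y' : Fin n) →
  toℕ x ≡ i + a → toℕ y ≡ j + b → toℕ x' ≡ i' + a → toℕ y' ≡ j' + b →
  M x' y' ≡ M x y

Crosses : {n : ℕ} → (ℓ i' j' : ℕ) → Pos n → Set
Crosses ℓ i' j' (pa , pb) =
  (i' ≤ toℕ pa × toℕ pa < i' + ℓ) × (j' ≤ toℕ pb × toℕ pb < j' + ℓ)

IsAttractor2D : {A : Set} {n : ℕ} → Matrix A n → List (Pos n) → Set
IsAttractor2D {n = n} M Γ =
  (ℓ i j : ℕ) → 1 ≤ ℓ → i + ℓ ≤ n → j + ℓ ≤ n →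
  ∃ λ i' → ∃ λ j' → i' + ℓ ≤ n × j' + ℓ ≤ n × SameSquare M ℓ i j i' j' ×
    ∃ λ p → p ∈ Γ × Crosses ℓ i' j' p

-- The 2D block tree (2D-BT) built using Γ, with parameters k, α, and
-- r = √γ, where n = r · k^α.
-- Depth d (= paper level ℓ = d+1), 0 ≤ d ≤ α: blocks are aligned squares of
-- side s d = k^(α ∸ d); a block at depth d is identified by its block
-- coordinates (bi , bj), covering rows bi·s .. bi·s+s-1 and columns
-- bj·s .. bj·s+s-1.

module BlockTree {n : ℕ} (Γ : List (Pos n)) (r k α : ℕ) where

  side : ℕ → ℕ
  side d = k ^ (α ∸ d)

  inBlock : ℕ → ℕ → ℕ → Set
  inBlock d b x = b * side d ≤ x × x < b * side d + side d

  inBlock? : ∀ d b x → Dec (inBlock d b x)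
  inBlock? d b x = (b * side d ≤? x) ×-dec (x <? b * side d + side d)

  Contains : ℕ → ℕ × ℕ → Set
  Contains d (bi , bj) = Any (λ p → inBlock d bi (toℕ (proj₁ p)) × inBlock d bj (toℕ (proj₂ p))) Γ

  contains? : ∀ d c → Dec (Contains d c)
  contains? d (bi , bj) = any? (λ p → inBlock? d bi (toℕ (proj₁ p)) ×-dec inBlock? d bj (toℕ (proj₂ p))) Γ

  near : ℕ → List ℕ
  near zero = zero ∷ 1 ∷ []
  near (suc b) = suc b ∷ suc (suc b) ∷ b ∷ []

  neighbourhood : ℕ × ℕ → List (ℕ × ℕ)
  neighbourhood (bi , bj) = concatMap (λ x → map (λ y → (x , y)) (near bj)) (near bi)

  Marked : ℕ → ℕ × ℕ → Set
  Marked d c = Any (Contains d) (neighbourhood c)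

  marked? : ∀ d c → Dec (Marked d c)
  marked? d c = any? (contains? d) (neighbourhood c)

  children : ℕ × ℕ → List (ℕ × ℕ)
  children (bi , bj) =
    concatMap (λ a → map (λ b → (bi * k + a , bj * k + b)) (upTo k)) (upTo k)

  nodesAt : ℕ → List (ℕ × ℕ)
  nodesAt zero = concatMap (λ a → map (λ b → (a , b)) (upTo r)) (upTo r)
  nodesAt (suc d) = concatMap children (filter (marked? d) (nodesAt d))

  -- total number of nodes: the root plus all nodes of depths 0 .. α
  -- (depth α blocks have side 1 = k^0 and are not split further)
  numNodes : ℕ
  numNodes = 1 + sum (map (λ d → length (nodesAt d)) (upTo (suc α)))

-- Space (in words) of the 2D-BT: each node occupies O(1) words, so up to a
-- constant factor the space is the number of nodes.
bt2DSpace : {n : ℕ} → List (Pos n) → (r k α : ℕ) → ℕ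
bt2DSpace Γ r k α = BlockTree.numNodes Γ r k α

-- At every depth a marked block lies among the at most nine blocks around a block containing a
-- position of Γ, so there are at most 9γ marked blocks and at most 9k²γ nodes one level further down;
-- counting this way needs the nodes of a depth to be distinct, which holds because a child block
-- determines its parent by division by k. The γ = r² blocks of depth 0 obey the same bound, so the
-- 1 + α depths and the root give at most (1 + 9k²)γ(1 + α) nodes.
module Submission where

open import Defs
open import Data.Nat using (ℕ; zero; suc; _+_; _*_; _^_; _∸_; _≤_; _<_; z≤n; s≤s; NonZero; >-nonZero; _/_)
open import Data.Nat.Properties
open import Data.Nat.DivMod using (m*n/n≡m; /-monoˡ-≤; m<n*o⇒m/o<n)
open import Data.Nat.ListAction using (sum)
open import Data.Nat.Tactic.RingSolver using (solve-∀)
open import Data.Fin using (toℕ)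
open import Function using (_∘_)
open import Data.Product using (∃; _×_; _,_; proj₁; proj₂)
open import Data.List
  using (List; []; _∷_; _++_; length; map; concatMap; upTo; filter; cartesianProductWith; cartesianProduct)
open import Data.List.Properties using (length-map; length-upTo; length-++; length-removeAt′)
open import Data.List.Membership.Propositional using (_∈_; _─_; find; lose)
open import Data.List.Membership.Propositional.Properties
  using ( ∈-concatMap⁺; ∈-cartesianProduct⁺; ∈-cartesianProduct⁻; ∈-cartesianProductWith⁻
        ; ∈-upTo⁻; ∈-filter⁻)
open import Data.List.Relation.Binary.Subset.Propositional using (_⊆_)
open import Data.List.Relation.Binary.Disjoint.Propositional using (Disjoint)
open import Data.List.Relation.Unary.Any using (here; there; index)
import Data.List.Relation.Unary.All as All
import Data.List.Relation.Unary.All.Properties as All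
import Data.List.Relation.Unary.AllPairs as AllPairs
import Data.List.Relation.Unary.AllPairs.Properties as AllPairs
open import Data.List.Relation.Unary.Unique.Propositional using (Unique; []; _∷_)
open import Data.List.Relation.Unary.Unique.Propositional.Properties
  using (concat⁺; cartesianProductWith⁺; cartesianProduct⁺; upTo⁺; filter⁺)
open import Relation.Binary.PropositionalEquality
  using (_≡_; _≢_; refl; sym; trans; cong; cong₂; subst; module ≡-Reasoning)
open import Relation.Nullary using (contradiction)

module _ {A B : Set} where

  length-concatMap-≤ : ∀ (f : A → List B) {m} xs → (∀ x → length (f x) ≤ m) →
                       length (concatMap f xs) ≤ length xs * m
  length-concatMap-≤ f []       _ = z≤n
  length-concatMap-≤ f (x ∷ xs) h = begin
    length (f x ++ concatMap f xs)          ≡⟨ length-++ (f x) ⟩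
    length (f x) + length (concatMap f xs)  ≤⟨ +-mono-≤ (h x) (length-concatMap-≤ f xs h) ⟩
    _                                       ∎
    where open ≤-Reasoning

  Unique-concatMap⁺ : ∀ (f : A → List B) {xs} → Unique xs → (∀ x → Unique (f x)) →
                      (∀ {x y} → x ≢ y → Disjoint (f x) (f y)) → Unique (concatMap f xs)
  Unique-concatMap⁺ f u fu disj =
    concat⁺ (All.map⁺ (All.universal fu _)) (AllPairs.map⁺ (AllPairs.map disj u))

module _ {A B C : Set} (f : A → B → C) (ys : List B) where

  concatMap-map≡cartesianProductWith : ∀ xs →
    concatMap (λ x → map (f x) ys) xs ≡ cartesianProductWith f xs ys
  concatMap-map≡cartesianProductWith []       = refl
  concatMap-map≡cartesianProductWith (x ∷ xs) =
    cong (map (f x) ys ++_) (concatMap-map≡cartesianProductWith xs)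

  length-cartesianProductWith : ∀ xs → length (cartesianProductWith f xs ys) ≡ length xs * length ys
  length-cartesianProductWith []       = refl
  length-cartesianProductWith (x ∷ xs) = begin
    length (map (f x) ys ++ cartesianProductWith f xs ys)
      ≡⟨ length-++ (map (f x) ys) ⟩
    length (map (f x) ys) + length (cartesianProductWith f xs ys)
      ≡⟨ cong₂ _+_ (length-map (f x) ys) (length-cartesianProductWith xs) ⟩
    length ys + length xs * length ys
      ∎
    where open ≡-Reasoning

sum-map-≤ : ∀ (f : ℕ → ℕ) {m} xs → (∀ x → f x ≤ m) → sum (map f xs) ≤ length xs * m
sum-map-≤ f []       _ = z≤n
sum-map-≤ f (x ∷ xs) h = +-mono-≤ (h x) (sum-map-≤ f xs h)

module _ {A : Set} where

  ∈-─⁺ : ∀ {x y : A} {ys} (x∈ys : x ∈ ys) → y ∈ ys → y ≢ x → y ∈ ys ─ x∈ys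
  ∈-─⁺ (here refl) (here refl) y≢x = contradiction refl y≢x
  ∈-─⁺ (here refl) (there y∈ys) _   = y∈ys
  ∈-─⁺ (there _)   (here refl)  _   = here refl
  ∈-─⁺ (there x∈ys) (there y∈ys) y≢x = there (∈-─⁺ x∈ys y∈ys y≢x)

  Unique-⊆⇒length-≤ : ∀ {xs ys : List A} → Unique xs → xs ⊆ ys → length xs ≤ length ys
  Unique-⊆⇒length-≤             []           _   = z≤n
  Unique-⊆⇒length-≤ {x ∷ xs} {ys} (x∉xs ∷ xs!) xs⊆ys = begin
    suc (length xs)            ≤⟨ s≤s (Unique-⊆⇒length-≤ xs! xs⊆ys─x) ⟩
    suc (length (ys ─ x∈ys))   ≡⟨ sym (length-removeAt′ ys (index x∈ys)) ⟩
    length ys                  ∎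
    where
      open ≤-Reasoning
      x∈ys = xs⊆ys (here refl)
      xs⊆ys─x : xs ⊆ ys ─ x∈ys
      xs⊆ys─x y∈xs = ∈-─⁺ x∈ys (xs⊆ys (there y∈xs)) (All.lookup x∉xs y∈xs ∘ sym)

n*o≤m<n*o+o⇒m/o≡n : ∀ {m n o} .{{_ : NonZero o}} → n * o ≤ m → m < n * o + o → m / o ≡ n
n*o≤m<n*o+o⇒m/o≡n {m} {n} {o} lo hi = ≤-antisym
  (m<1+n⇒m≤n (m<n*o⇒m/o<n (subst (m <_) (+-comm (n * o) o) hi)))
  (subst (_≤ m / o) (m*n/n≡m n o) (/-monoˡ-≤ o lo))

module BlockTreeSize {n : ℕ} (Γ : List (Pos n)) (r k α : ℕ) .{{_ : NonZero k}} where
  open BlockTree Γ r k α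

  γ : ℕ
  γ = length Γ

  near-sym : ∀ {a b} → b ∈ near a → a ∈ near b
  near-sym {zero}        (here refl)                 = here refl
  near-sym {zero}        (there (here refl))         = there (there (here refl))
  near-sym {suc a}       (here refl)                 = here refl
  near-sym {suc a}       (there (here refl))         = there (there (here refl))
  near-sym {suc zero}    (there (there (here refl))) = there (here refl)
  near-sym {suc (suc a)} (there (there (here refl))) = there (here refl)

  length-near : ∀ b → length (near b) ≤ 3
  length-near zero    = s≤s (s≤s z≤n)
  length-near (suc b) = ≤-refl

  neighbourhood≡cartesianProduct : ∀ c →
    neighbourhood c ≡ cartesianProduct (near (proj₁ c)) (near (proj₂ c))
  neighbourhood≡cartesianProduct (bi , bj) = concatMap-map≡cartesianProductWith _,_ (near bj) (near bi)

  length-neighbourhood : ∀ c → length (neighbourhood c) ≤ 9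
  length-neighbourhood c@(bi , bj) = begin
    length (neighbourhood c)                       ≡⟨ cong length (neighbourhood≡cartesianProduct c) ⟩
    length (cartesianProduct (near bi) (near bj))  ≡⟨ length-cartesianProductWith _,_ (near bj) (near bi) ⟩
    length (near bi) * length (near bj)            ≤⟨ *-mono-≤ (length-near bi) (length-near bj) ⟩
    9                                              ∎
    where open ≤-Reasoning

  neighbourhood-sym : ∀ {c c'} → c' ∈ neighbourhood c → c ∈ neighbourhood c'
  neighbourhood-sym {c} {c'} c'∈N[c]
    with bi' , bj' ← ∈-cartesianProduct⁻ _ _ (subst (c' ∈_) (neighbourhood≡cartesianProduct c) c'∈N[c])
    = subst (c ∈_) (sym (neighbourhood≡cartesianProduct c'))
        (∈-cartesianProduct⁺ (near-sym bi') (near-sym bj'))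

  blockIndex : ℕ → ℕ → ℕ
  blockIndex d x = _/_ x (side d) {{m^n≢0 k (α ∸ d)}}

  inBlock⇒blockIndex≡ : ∀ d {b x} → inBlock d b x → blockIndex d x ≡ b
  inBlock⇒blockIndex≡ d (lo , hi) = n*o≤m<n*o+o⇒m/o≡n {{m^n≢0 k (α ∸ d)}} lo hi

  blockOf : ℕ → Pos n → ℕ × ℕ
  blockOf d (x , y) = blockIndex d (toℕ x) , blockIndex d (toℕ y)

  Contains⇒≡blockOf : ∀ d c → Contains d c → ∃ λ p → p ∈ Γ × blockOf d p ≡ c
  Contains⇒≡blockOf d _ c∋Γ = let p , p∈Γ , (x∈bi , y∈bj) = find c∋Γ in
    p , p∈Γ , cong₂ _,_ (inBlock⇒blockIndex≡ d x∈bi) (inBlock⇒blockIndex≡ d y∈bj)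

  attractorNeighbourhoods : ℕ → List (ℕ × ℕ)
  attractorNeighbourhoods d = concatMap (neighbourhood ∘ blockOf d) Γ

  length-attractorNeighbourhoods : ∀ d → length (attractorNeighbourhoods d) ≤ γ * 9
  length-attractorNeighbourhoods d =
    length-concatMap-≤ (neighbourhood ∘ blockOf d) Γ (length-neighbourhood ∘ blockOf d)

  Marked⇒∈attractorNeighbourhoods : ∀ {d c} → Marked d c → c ∈ attractorNeighbourhoods d
  Marked⇒∈attractorNeighbourhoods {d} {c} marked =
    let c' , c'∈N[c] , c'∋Γ = find marked
        p , p∈Γ , p∈c'     = Contains⇒≡blockOf d c' c'∋Γ
    in ∈-concatMap⁺ (neighbourhood ∘ blockOf d)
         (lose p∈Γ (subst (λ b → c ∈ neighbourhood b) (sym p∈c') (neighbourhood-sym c'∈N[c])))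

  parent : ℕ × ℕ → ℕ × ℕ
  parent (x , y) = x / k , y / k

  childAt : ℕ × ℕ → ℕ → ℕ → ℕ × ℕ
  childAt (bi , bj) a b = bi * k + a , bj * k + b

  children≡cartesianProductWith : ∀ c → children c ≡ cartesianProductWith (childAt c) (upTo k) (upTo k)
  children≡cartesianProductWith c@(_ , _) = concatMap-map≡cartesianProductWith (childAt c) (upTo k) (upTo k)

  length-children : ∀ c → length (children c) ≡ k * k
  length-children c = begin
    length (children c)
      ≡⟨ cong length (children≡cartesianProductWith c) ⟩
    length (cartesianProductWith (childAt c) (upTo k) (upTo k))
      ≡⟨ length-cartesianProductWith (childAt c) (upTo k) (upTo k) ⟩
    length (upTo k) * length (upTo k)
      ≡⟨ cong₂ _*_ (length-upTo k) (length-upTo k) ⟩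
    k * k
      ∎
    where open ≡-Reasoning

  Unique-children : ∀ c → Unique (children c)
  Unique-children c@(bi , bj) = subst Unique (sym (children≡cartesianProductWith c))
    (cartesianProductWith⁺ (childAt c) childAt-injective (upTo⁺ k) (upTo⁺ k))
    where
      childAt-injective : ∀ {a a' b b'} → childAt c a b ≡ childAt c a' b' → a ≡ a' × b ≡ b'
      childAt-injective eq =
        +-cancelˡ-≡ (bi * k) _ _ (cong proj₁ eq) , +-cancelˡ-≡ (bj * k) _ _ (cong proj₂ eq)

  ∈-children⇒parent≡ : ∀ {c z} → z ∈ children c → parent z ≡ c
  ∈-children⇒parent≡ {c@(bi , bj)} z∈children
    with a , b , a∈ , b∈ , refl ← ∈-cartesianProductWith⁻ (childAt c) (upTo k) (upTo k)
                                     (subst (_ ∈_) (children≡cartesianProductWith c) z∈children)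
    = cong₂ _,_ ([m*k+a]/k≡m bi (∈-upTo⁻ a∈)) ([m*k+a]/k≡m bj (∈-upTo⁻ b∈))
    where
      [m*k+a]/k≡m : ∀ m {a} → a < k → (m * k + a) / k ≡ m
      [m*k+a]/k≡m m a<k = n*o≤m<n*o+o⇒m/o≡n (m≤m+n (m * k) _) (+-monoʳ-< (m * k) a<k)

  Unique-nodesAt : ∀ d → Unique (nodesAt d)
  Unique-nodesAt zero    = subst Unique (sym (concatMap-map≡cartesianProductWith _,_ (upTo r) (upTo r)))
                             (cartesianProduct⁺ (upTo⁺ r) (upTo⁺ r))
  Unique-nodesAt (suc d) =
    Unique-concatMap⁺ children (filter⁺ (marked? d) (Unique-nodesAt d)) Unique-children children-disjoint
    where
      children-disjoint : ∀ {c c'} → c ≢ c' → Disjoint (children c) (children c')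
      children-disjoint c≢c' (z∈ , z∈') =
        c≢c' (trans (sym (∈-children⇒parent≡ z∈)) (∈-children⇒parent≡ z∈'))

  length-markedAt : ∀ d → length (filter (marked? d) (nodesAt d)) ≤ γ * 9
  length-markedAt d = ≤-trans
    (Unique-⊆⇒length-≤ (filter⁺ (marked? d) (Unique-nodesAt d))
      (Marked⇒∈attractorNeighbourhoods {d} ∘ proj₂ ∘ ∈-filter⁻ (marked? d) {xs = nodesAt d}))
    (length-attractorNeighbourhoods d)

  length-nodesAt : γ ≡ r * r → ∀ d → length (nodesAt d) ≤ γ * 9 * (k * k)
  length-nodesAt γ≡r² zero = begin
    length (nodesAt zero)                        ≡⟨ cong length grid ⟩
    length (cartesianProduct (upTo r) (upTo r))  ≡⟨ length-cartesianProductWith _,_ (upTo r) (upTo r) ⟩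
    length (upTo r) * length (upTo r)            ≡⟨ cong₂ _*_ (length-upTo r) (length-upTo r) ⟩
    r * r                                        ≡⟨ sym γ≡r² ⟩
    γ                                            ≤⟨ m≤m*n γ 9 ⟩
    γ * 9                                        ≤⟨ m≤m*n (γ * 9) (k * k) {{m*n≢0 k k}} ⟩
    γ * 9 * (k * k)                              ∎
    where
      open ≤-Reasoning
      grid = concatMap-map≡cartesianProductWith _,_ (upTo r) (upTo r)
  length-nodesAt _ (suc d) = begin
    length (concatMap children markedAt)
      ≤⟨ length-concatMap-≤ children markedAt (≤-reflexive ∘ length-children) ⟩
    length markedAt * (k * k)
      ≤⟨ *-monoˡ-≤ (k * k) (length-markedAt d) ⟩
    γ * 9 * (k * k)
      ∎
    where
      open ≤-Reasoning
      markedAt = filter (marked? d) (nodesAt d)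

  numNodes-≤ : 1 ≤ γ → γ ≡ r * r → numNodes ≤ (1 + 9 * (k * k)) * γ * (1 + α)
  numNodes-≤ 1≤γ γ≡r² = begin
    1 + sum (map (length ∘ nodesAt) (upTo (1 + α)))
      ≤⟨ +-mono-≤ (m≤n⇒m≤n*o (1 + α) 1≤γ)
                  (sum-map-≤ (length ∘ nodesAt) (upTo (1 + α)) (length-nodesAt γ≡r²)) ⟩
    γ * (1 + α) + length (upTo (1 + α)) * (γ * 9 * (k * k))
      ≡⟨ cong (λ l → γ * (1 + α) + l * (γ * 9 * (k * k))) (length-upTo (1 + α)) ⟩
    γ * (1 + α) + (1 + α) * (γ * 9 * (k * k))
      ≡⟨ collect γ α k ⟩
    (1 + 9 * (k * k)) * γ * (1 + α)
      ∎
    where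
      open ≤-Reasoning
      collect : ∀ g a k → g * (1 + a) + (1 + a) * (g * 9 * (k * k)) ≡ (1 + 9 * (k * k)) * g * (1 + a)
      collect = solve-∀

1≤r*m⇒1≤r*r : ∀ r {m} → 1 ≤ r * m → 1 ≤ r * r
1≤r*m⇒1≤r*r (suc r) _ = s≤s z≤n

theorem4 : (k : ℕ) → 2 ≤ k →
    ∃ λ (C : ℕ) →
      (A : Set) (n : ℕ) (M : Matrix A n) (Γ : List (Pos n)) (r α : ℕ) →
      Unique Γ → IsAttractor2D M Γ →
      1 ≤ n → length Γ ≡ r * r → n ≡ r * k ^ α →
      bt2DSpace Γ r k α ≤ C * length Γ * (1 + α)
theorem4 k 2≤k = 1 + 9 * (k * k) , λ A n M Γ r α _ _ 1≤n γ≡r² n≡r*kᵅ →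
  BlockTreeSize.numNodes-≤ Γ r k α {{>-nonZero (≤-trans (s≤s z≤n) 2≤k)}}
    (subst (1 ≤_) (sym γ≡r²) (1≤r*m⇒1≤r*r r (subst (1 ≤_) n≡r*kᵅ 1≤n)))
    γ≡r²
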